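{- Let $m\ge9$ be an integer and let $\alpha,\beta$ be non-negative integers. Assume that $P_{m,(1^\alpha,2^\beta)}$ is universal. Then: (1) $P_{m,(1^{\alpha'},2^{\beta'})}$ is universal for any integers $\alpha'\ge\alpha$ and $\beta'\ge\beta$; (2) $P_{m,(1^{\alpha+2\beta'},2^{\beta-\beta'})}$ is universal for any integer $0\le\beta'\le\beta$; (3) $\alpha\ge\max(m-2\beta-4,1)$; (4) if $\beta=\lfloor m/2\rfloor-2$, then $\alpha\ge2$.
   Context: For $x\in\mathbb{Z}$, $P_m(x)=(m-2)\frac{x^2-x}{2}+x$. For $\bm a=(a_1,\dots,a_k)\in\mathbb{N}^k$, $P_{m,\bm a}(\bm x)=\sum_{i=1}^k a_iP_m(x_i)$ for $\bm x\in\mathbb{Z}^k$. The vector $(1^\alpha,2^\beta)$ consists of $\alpha$ entries $1$ followed by $\beta$ entries $2$. $P_{m,\bm a}$ is universal if every non-negative integer equals $P_{m,\bm a}(\bm x)$ for some $\bm x\in\mathbb{Z}^k$. -}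

module Defs where

open import Data.Nat using (ℕ; zero; suc; _+_)
open import Data.Integer using (ℤ; +_; -[1+_]) renaming (_+_ to _+ℤ_; _*_ to _*ℤ_)
open import Data.Vec using (Vec; []; _∷_; replicate; _++_)
open import Data.Product using (∃)
open import Relation.Binary.PropositionalEquality using (_≡_)

tri : ℕ → ℕ
tri zero    = zero
tri (suc k) = suc k + tri k

-- T x = (x^2 - x)/2 for x ∈ ℤ (always an integer, non-negative)
T : ℤ → ℤ
T (+ zero)    = + 0
T (+ suc n)   = + tri n          -- (n+1)n/2
T -[1+ n ]    = + tri (suc n)    -- (-(n+1))(-(n+2))/2 = (n+1)(n+2)/2

P : ℕ → ℤ → ℤ
P m x = ((+ m) Data.Integer.- (+ 2)) *ℤ T x +ℤ x

Pa : ℕ → {k : ℕ} → Vec ℕ k → Vec ℤ k → ℤ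
Pa m []       []       = + 0
Pa m (a ∷ as) (x ∷ xs) = (+ a) *ℤ P m x +ℤ Pa m as xs

Universal : ℕ → {k : ℕ} → Vec ℕ k → Set
Universal m {k} a = (n : ℕ) → ∃ λ (x : Vec ℤ k) → Pa m a x ≡ + n

oneTwo : (α β : ℕ) → Vec ℕ (α + β)
oneTwo α β = replicate α 1 ++ replicate β 2

{-# OPTIONS --safe #-}
-- The values of P_m (m ≥ 4) are 0, 1, m − 3 and numbers ≥ m. Hence a value of P_{m,a} below
-- m − 3 only uses P_m(xᵢ) ∈ {0, 1} and is at most Σ aᵢ: representing m − 4 gives α + 2β ≥ m − 4,
-- and representing 1 needs a coefficient 1, since P_{m,(2^β)} only takes even values.
-- Parts (1) and (2) hold because padding with zero variables and splitting 2 P_m(x) into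
-- P_m(x) + P_m(x) can only enlarge the set of values.
module Submission where

open import Defs
open import Data.Nat using (ℕ; zero; suc; _+_; _*_; _∸_; _≤_; _⊔_; _/_; z≤n; s≤s)
open import Data.Nat.Properties
open import Data.Nat.DivMod using (m/n*n≤m)
open import Data.Nat.Divisibility using (divides; ∣1⇒≡1)
open import Data.Integer using (ℤ; +_; -[1+_]; _⊖_)
  renaming (_+_ to _+ℤ_; _-_ to _-ℤ_; _*_ to _*ℤ_)
import Data.Integer.Properties as ℤ
open import Data.Integer.Tactic.RingSolver using (solve-∀)
open import Data.Vec using (Vec; []; _∷_; replicate; _++_; splitAt; sum)
open import Data.Vec.Properties using (sum-++)
open import Data.Product using (_×_; _,_; ∃)
open import Data.Sum using (_⊎_; inj₁; inj₂; map₁)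
open import Data.Empty using (⊥; ⊥-elim)
open import Relation.Nullary using (contradiction)
open import Relation.Binary.PropositionalEquality

replicate-++ : ∀ {A : Set} p {q} (a : A) → replicate (p + q) a ≡ replicate p a ++ replicate q a
replicate-++ zero    a = refl
replicate-++ (suc p) a = cong (a ∷_) (replicate-++ p a)

sum-replicate : ∀ n a → sum (replicate n a) ≡ n * a
sum-replicate zero    a = refl
sum-replicate (suc n) a = cong (_+_ a) (sum-replicate n a)

sum-oneTwo : ∀ α β → sum (oneTwo α β) ≡ α + 2 * β
sum-oneTwo α β = begin
  sum (replicate α 1 ++ replicate β 2)         ≡⟨ sum-++ (replicate α 1) ⟩
  sum (replicate α 1) + sum (replicate β 2)
    ≡⟨ cong₂ _+_ (sum-replicate α 1) (sum-replicate β 2) ⟩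
  α * 1 + β * 2                                ≡⟨ cong₂ _+_ (*-identityʳ α) (*-comm β 2) ⟩
  α + 2 * β                                    ∎
  where open ≡-Reasoning

2*n≢1 : ∀ n → 2 * n ≢ 1
2*n≢1 n eq with ∣1⇒≡1 (divides n (trans (sym eq) (*-comm 2 n)))
... | ()

2*[n/2∸2]≤n∸4 : ∀ n → 2 * (n / 2 ∸ 2) ≤ n ∸ 4
2*[n/2∸2]≤n∸4 n = begin
  2 * (n / 2 ∸ 2)   ≡⟨ *-distribˡ-∸ 2 (n / 2) 2 ⟩
  2 * (n / 2) ∸ 4   ≤⟨ ∸-monoˡ-≤ 4 (≤-trans (≤-reflexive (*-comm 2 (n / 2))) (m/n*n≤m n 2)) ⟩
  n ∸ 4             ∎
  where open ≤-Reasoning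

P-zero : ∀ m → P m (+ 0) ≡ + 0
P-zero m = cong (_+ℤ + 0) (ℤ.*-zeroʳ (+ m -ℤ + 2))

Pa-++ : ∀ m {p q} (a : Vec ℕ p) (b : Vec ℕ q) x y →
        Pa m (a ++ b) (x ++ y) ≡ Pa m a x +ℤ Pa m b y
Pa-++ m []      b []      y = sym (ℤ.+-identityˡ _)
Pa-++ m (c ∷ a) b (z ∷ x) y = trans (cong (+ c *ℤ P m z +ℤ_) (Pa-++ m a b x y))
                                    (sym (ℤ.+-assoc (+ c *ℤ P m z) (Pa m a x) (Pa m b y)))

Pa-zeros : ∀ m {n} (a : Vec ℕ n) → Pa m a (replicate n (+ 0)) ≡ + 0
Pa-zeros m []      = refl
Pa-zeros m (c ∷ a) rewrite P-zero m | Pa-zeros m a | ℤ.*-zeroʳ (+ c) = refl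

Pa-replicate-2 : ∀ m {n} (x : Vec ℤ n) → Pa m (replicate n 2) x ≡ + 2 *ℤ Pa m (replicate n 1) x
Pa-replicate-2 m []      = refl
Pa-replicate-2 m (z ∷ x) rewrite Pa-replicate-2 m x = distrib (P m z) (Pa m (replicate _ 1) x)
  where
  distrib : ∀ p r → + 2 *ℤ p +ℤ + 2 *ℤ r ≡ + 2 *ℤ (+ 1 *ℤ p +ℤ r)
  distrib = solve-∀

infix 4 _≼[_]_

record _≼[_]_ {p q} (a : Vec ℕ p) (m : ℕ) (b : Vec ℕ q) : Set where
  constructor covers
  field cover : ∀ x → ∃ λ y → Pa m b y ≡ Pa m a x

open _≼[_]_

Universal-≼ : ∀ {m p q} {a : Vec ℕ p} {b : Vec ℕ q} →
              a ≼[ m ] b → Universal m a → Universal m b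
Universal-≼ a≼b U n with U n
... | x , eq with cover a≼b x
...   | y , eq′ = y , trans eq′ eq

≼-refl : ∀ {m p} {a : Vec ℕ p} → a ≼[ m ] a
≼-refl = covers λ x → x , refl

≼-trans : ∀ {m p q r} {a : Vec ℕ p} {b : Vec ℕ q} {c : Vec ℕ r} →
          a ≼[ m ] b → b ≼[ m ] c → a ≼[ m ] c
≼-trans {m} {a = a} {c = c} a≼b b≼c = covers go
  where
  go : ∀ x → ∃ λ z → Pa m c z ≡ Pa m a x
  go x with cover a≼b x
  ... | y , eq with cover b≼c y
  ...   | z , eq′ = z , trans eq′ eq

≼-++⁺ : ∀ {m p p′ q q′} {a : Vec ℕ p} {a′ : Vec ℕ p′} {b : Vec ℕ q} {b′ : Vec ℕ q′} →
        a ≼[ m ] a′ → b ≼[ m ] b′ → a ++ b ≼[ m ] a′ ++ b′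
≼-++⁺ {m} {p} {a = a} {a′} {b} {b′} a≼a′ b≼b′ = covers go
  where
  go : ∀ x → ∃ λ y → Pa m (a′ ++ b′) y ≡ Pa m (a ++ b) x
  go x with splitAt p x
  ... | xa , xb , refl with cover a≼a′ xa | cover b≼b′ xb
  ...   | ya , eqa | yb , eqb = ya ++ yb , (begin
    Pa m (a′ ++ b′) (ya ++ yb)   ≡⟨ Pa-++ m a′ b′ ya yb ⟩
    Pa m a′ ya +ℤ Pa m b′ yb     ≡⟨ cong₂ _+ℤ_ eqa eqb ⟩
    Pa m a xa +ℤ Pa m b xb       ≡⟨ Pa-++ m a b xa xb ⟨
    Pa m (a ++ b) (xa ++ xb)     ∎)
    where open ≡-Reasoning

≼-++ʳ : ∀ {m p q} (a : Vec ℕ p) (b : Vec ℕ q) → a ≼[ m ] a ++ b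
≼-++ʳ {m} {q = q} a b = covers λ x → x ++ replicate q (+ 0) , pad x
  where
  open ≡-Reasoning
  pad : ∀ x → Pa m (a ++ b) (x ++ replicate q (+ 0)) ≡ Pa m a x
  pad x = begin
    Pa m (a ++ b) (x ++ replicate q (+ 0))   ≡⟨ Pa-++ m a b x _ ⟩
    Pa m a x +ℤ Pa m b (replicate q (+ 0))   ≡⟨ cong (Pa m a x +ℤ_) (Pa-zeros m b) ⟩
    Pa m a x +ℤ + 0                          ≡⟨ ℤ.+-identityʳ (Pa m a x) ⟩
    Pa m a x                                 ∎

≼-++-assoc : ∀ {m p q r} (a : Vec ℕ p) (b : Vec ℕ q) (c : Vec ℕ r) →
             a ++ (b ++ c) ≼[ m ] (a ++ b) ++ c
≼-++-assoc {m} {p} {q} a b c = covers go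
  where
  open ≡-Reasoning
  go : ∀ x → ∃ λ y → Pa m ((a ++ b) ++ c) y ≡ Pa m (a ++ (b ++ c)) x
  go x with splitAt p x
  ... | xa , xbc , refl with splitAt q xbc
  ...   | xb , xc , refl = (xa ++ xb) ++ xc , (begin
    Pa m ((a ++ b) ++ c) ((xa ++ xb) ++ xc)      ≡⟨ Pa-++ m (a ++ b) c (xa ++ xb) xc ⟩
    Pa m (a ++ b) (xa ++ xb) +ℤ Pa m c xc        ≡⟨ cong (_+ℤ Pa m c xc) (Pa-++ m a b xa xb) ⟩
    Pa m a xa +ℤ Pa m b xb +ℤ Pa m c xc          ≡⟨ ℤ.+-assoc (Pa m a xa) (Pa m b xb) (Pa m c xc) ⟩
    Pa m a xa +ℤ (Pa m b xb +ℤ Pa m c xc)        ≡⟨ cong (Pa m a xa +ℤ_) (Pa-++ m b c xb xc) ⟨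
    Pa m a xa +ℤ Pa m (b ++ c) (xb ++ xc)        ≡⟨ Pa-++ m a (b ++ c) xa (xb ++ xc) ⟨
    Pa m (a ++ (b ++ c)) (xa ++ (xb ++ xc))      ∎)

replicate-2-≼ : ∀ {m} n → replicate n 2 ≼[ m ] replicate (2 * n) 1
replicate-2-≼ {m} n = covers λ x → x ++ (x ++ []) , twice x
  where
  open ≡-Reasoning
  double : ∀ r → r +ℤ (r +ℤ + 0) ≡ + 2 *ℤ r
  double = solve-∀
  twice : ∀ x → Pa m (replicate (2 * n) 1) (x ++ (x ++ [])) ≡ Pa m (replicate n 2) x
  twice x = begin
    Pa m (replicate (n + (n + 0)) 1) (x ++ (x ++ []))
      ≡⟨ cong (λ a → Pa m a (x ++ (x ++ []))) (replicate-++ n 1) ⟩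
    Pa m (replicate n 1 ++ replicate (n + 0) 1) (x ++ (x ++ []))
      ≡⟨ Pa-++ m (replicate n 1) _ x (x ++ []) ⟩
    r +ℤ Pa m (replicate (n + 0) 1) (x ++ [])
      ≡⟨ cong (λ a → r +ℤ Pa m a (x ++ [])) (replicate-++ n 1) ⟩
    r +ℤ Pa m (replicate n 1 ++ []) (x ++ [])
      ≡⟨ cong (r +ℤ_) (Pa-++ m (replicate n 1) [] x []) ⟩
    r +ℤ (r +ℤ + 0)
      ≡⟨ double r ⟩
    + 2 *ℤ r
      ≡⟨ Pa-replicate-2 m x ⟨
    Pa m (replicate n 2) x ∎
    where r = Pa m (replicate n 1) x

oneTwo-≼ : ∀ {m} α d β e → oneTwo α β ≼[ m ] oneTwo (α + d) (β + e)
oneTwo-≼ α d β e rewrite replicate-++ α {d} 1 | replicate-++ β {e} 2 =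
  ≼-++⁺ (≼-++ʳ (replicate α 1) (replicate d 1)) (≼-++ʳ (replicate β 2) (replicate e 2))

oneTwo-halve-≼ : ∀ {m} α β e → oneTwo α (β + e) ≼[ m ] oneTwo (α + 2 * β) e
oneTwo-halve-≼ α β e rewrite replicate-++ β {e} 2 | replicate-++ α {2 * β} 1 =
  ≼-trans (≼-++⁺ (≼-refl {a = replicate α 1})
                  (≼-++⁺ (replicate-2-≼ β) (≼-refl {a = replicate e 2})))
          (≼-++-assoc (replicate α 1) (replicate (2 * β) 1) (replicate e 2))

Universal-oneTwo-mono : ∀ {m α β α′ β′} → α ≤ α′ → β ≤ β′ →
                        Universal m (oneTwo α β) → Universal m (oneTwo α′ β′)
Universal-oneTwo-mono {α = α} {β} α≤α′ β≤β′
  with m≤n⇒∃[o]m+o≡n α≤α′ | m≤n⇒∃[o]m+o≡n β≤β′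
... | d , refl | e , refl = Universal-≼ (oneTwo-≼ α d β e)

Universal-oneTwo-halve : ∀ {m α β β′} → β′ ≤ β →
                         Universal m (oneTwo α β) → Universal m (oneTwo (α + 2 * β′) (β ∸ β′))
Universal-oneTwo-halve {α = α} {β′ = β′} β′≤β with m≤n⇒∃[o]m+o≡n β′≤β
... | e , refl rewrite m+n∸m≡n β′ e = Universal-≼ (oneTwo-halve-≼ α β′ e)

P-negsuc : ∀ k n → P (4 + k) -[1+ n ] ≡ + (tri n + suc k * tri (suc n))
P-negsuc k n = begin
  + (2 + k) *ℤ + t +ℤ -[1+ n ]   ≡⟨ cong (_+ℤ -[1+ n ]) (ℤ.pos-* (2 + k) t) ⟨
  (2 + k) * t ⊖ suc n            ≡⟨ cong (_⊖ suc n) (+-assoc (suc n) (tri n) (suc k * t)) ⟩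
  (suc n + R) ⊖ suc n            ≡⟨ ℤ.⊖-≥ (m≤m+n (suc n) R) ⟩
  + (suc n + R ∸ suc n)          ≡⟨ cong +_ (m+n∸m≡n (suc n) R) ⟩
  + R                            ∎
  where
  open ≡-Reasoning
  t = tri (suc n)
  R = tri n + suc k * t

P-values : ∀ k x → ∃ λ v → P (4 + k) x ≡ + v × (v ≤ 1 ⊎ v ≡ 1 + k ⊎ 4 + k ≤ v)
P-values k (+ zero)        = 0 , P-zero (4 + k) , inj₁ z≤n
P-values k (+ suc zero)    = 1 , cong (_+ℤ + 1) (ℤ.*-zeroʳ (+ (2 + k))) , inj₁ ≤-refl
P-values k (+ suc (suc n)) =
  (2 + k) * t + (2 + n) , cong (_+ℤ + (2 + n)) (sym (ℤ.pos-* (2 + k) t)) ,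
  inj₂ (inj₂ (≤-trans (+-mono-≤ (s≤s (s≤s (z≤n {n}))) (m≤m*n (2 + k) t))
                      (≤-reflexive (+-comm (2 + n) ((2 + k) * t)))))
  where t = tri (suc n)
P-values k -[1+ zero ]     = _ , P-negsuc k 0 , inj₂ (inj₁ (*-identityʳ (suc k)))
P-values k -[1+ suc n ]    = _ , P-negsuc k (suc n) , inj₂ (inj₂ (+-mono-≤ (s≤s z≤n) 3+k≤))
  where
  t = tri (2 + n)
  3≤t : 3 ≤ t
  3≤t = s≤s (s≤s (≤-trans (s≤s z≤n) (m≤n+m (tri (suc n)) n)))
  3+k≤ : 3 + k ≤ suc k * t
  3+k≤ = +-mono-≤ 3≤t (m≤m*n k t)

P-gap : ∀ k x → ∃ λ v → P (4 + k) x ≡ + v × (v ≤ 1 ⊎ 1 + k ≤ v)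
P-gap k x with P-values k x
... | v , eq , inj₁ v≤1         = v , eq , inj₁ v≤1
... | v , eq , inj₂ (inj₁ refl) = v , eq , inj₂ ≤-refl
... | v , eq , inj₂ (inj₂ big)  = v , eq , inj₂ (≤-trans (m≤n+m (1 + k) 3) big)

Pa-gap : ∀ k {n} (a : Vec ℕ n) x → ∃ λ S → Pa (4 + k) a x ≡ + S × (S ≤ sum a ⊎ 1 + k ≤ S)
Pa-gap k []      []      = 0 , refl , inj₁ z≤n
Pa-gap k (c ∷ a) (y ∷ x) with P-gap k y | Pa-gap k a x
... | v , Py , gv | S , PaS , gS = c * v + S , value , gap c gv gS
  where
  value : + c *ℤ P (4 + k) y +ℤ Pa (4 + k) a x ≡ + (c * v + S)
  value = trans (cong₂ (λ p q → + c *ℤ p +ℤ q) Py PaS) (cong (_+ℤ + S) (sym (ℤ.pos-* c v)))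
  gap : ∀ c → v ≤ 1 ⊎ 1 + k ≤ v → S ≤ sum a ⊎ 1 + k ≤ S →
        c * v + S ≤ c + sum a ⊎ 1 + k ≤ c * v + S
  gap c       _          (inj₂ big) = inj₂ (≤-trans big (m≤n+m S (c * v)))
  gap c       (inj₁ v≤1) (inj₁ S≤)  =
    inj₁ (+-mono-≤ (≤-trans (*-monoʳ-≤ c v≤1) (≤-reflexive (*-identityʳ c))) S≤)
  gap zero    (inj₂ _)   (inj₁ S≤)  = inj₁ S≤
  gap (suc c) (inj₂ big) (inj₁ _)   =
    inj₂ (≤-trans big (≤-trans (m≤m+n v (c * v)) (m≤m+n _ S)))

Pa-replicate-2-gap : ∀ k {n} (x : Vec ℤ n) →
                     ∃ λ B → Pa (4 + k) (replicate n 2) x ≡ + (2 * B) × (B ≤ n ⊎ 1 + k ≤ B)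
Pa-replicate-2-gap k {n} x with Pa-gap k (replicate n 1) x
... | B , PaB , gap = B , even , map₁ (subst (B ≤_) (trans (sum-replicate n 1) (*-identityʳ n))) gap
  where
  even : Pa (4 + k) (replicate n 2) x ≡ + (2 * B)
  even = trans (Pa-replicate-2 (4 + k) x) (trans (cong (+ 2 *ℤ_) PaB) (sym (ℤ.pos-* 2 B)))

Universal⇒≤sum : ∀ k {n} (a : Vec ℕ n) → Universal (4 + k) a → k ≤ sum a
Universal⇒≤sum k a U with U k
... | x , eq with Pa-gap k a x
...   | S , PaS , gap with ℤ.+-injective (trans (sym PaS) eq)
...     | refl with gap
...       | inj₁ k≤sum = k≤sum
...       | inj₂ 1+k≤k = contradiction 1+k≤k 1+n≰n

Universal-oneTwo⇒1≤α : ∀ k {α β} → Universal (4 + k) (oneTwo α β) → 1 ≤ α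
Universal-oneTwo⇒1≤α k {suc _} _ = s≤s z≤n
Universal-oneTwo⇒1≤α k {zero} U with U 1
... | x , eq with Pa-replicate-2-gap k x
...   | B , even , _ = contradiction (ℤ.+-injective (trans (sym even) eq)) (2*n≢1 B)

Universal-oneTwo-lower-bound : ∀ k α β → Universal (4 + k) (oneTwo α β) →
                               ((4 + k) ∸ 2 * β) ∸ 4 ⊔ 1 ≤ α
Universal-oneTwo-lower-bound k α β U = ⊔-lub bound (Universal-oneTwo⇒1≤α k U)
  where
  open ≤-Reasoning
  k≤ : k ≤ 2 * β + α
  k≤ = ≤-trans (Universal⇒≤sum k (oneTwo α β) U)
               (≤-reflexive (trans (sum-oneTwo α β) (+-comm α (2 * β))))
  bound : ((4 + k) ∸ 2 * β) ∸ 4 ≤ α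
  bound = begin
    (4 + k ∸ 2 * β) ∸ 4   ≡⟨ ∸-+-assoc (4 + k) (2 * β) 4 ⟩
    4 + k ∸ (2 * β + 4)   ≡⟨ cong (4 + k ∸_) (+-comm (2 * β) 4) ⟩
    k ∸ 2 * β             ≤⟨ m≤n+o⇒m∸n≤o k (2 * β) k≤ ⟩
    α                     ∎

-- Writing m − 2 = P_m(y) + 2B, the bound on β forces 2B ≤ m − 4, so P_m(y) ≥ 2; being below m
-- it must be m − 3, and then 2B = 1.
Universal-oneTwo-threshold : ∀ j α β → Universal (5 + j) (oneTwo α β) →
                             β ≡ (5 + j) / 2 ∸ 2 → 2 ≤ α
Universal-oneTwo-threshold j zero          β U _ =
  contradiction (Universal-oneTwo⇒1≤α (suc j) {0} {β} U) λ ()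
Universal-oneTwo-threshold j (suc (suc _)) _ _ _ = s≤s (s≤s z≤n)
Universal-oneTwo-threshold j 1             β U β≡ with U (3 + j)
... | y ∷ z , eq with P-values (suc j) y | Pa-replicate-2-gap (suc j) z
...   | v , Pv , cv | B , PB , cB = ⊥-elim (impossible cv cB)
  where
  v+2B≡3+j : v + 2 * B ≡ 3 + j
  v+2B≡3+j = ℤ.+-injective (begin
    + v +ℤ + (2 * B)
      ≡⟨ cong₂ _+ℤ_ (trans (sym (ℤ.*-identityˡ (+ v))) (cong (+ 1 *ℤ_) (sym Pv))) (sym PB) ⟩
    + 1 *ℤ P (5 + j) y +ℤ Pa (5 + j) (replicate β 2) z
      ≡⟨ eq ⟩
    + (3 + j) ∎)
    where open ≡-Reasoning
  2B≤3+j : 2 * B ≤ 3 + j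
  2B≤3+j = ≤-trans (m≤n+m (2 * B) v) (≤-reflexive v+2B≡3+j)
  v≤3+j : v ≤ 3 + j
  v≤3+j = ≤-trans (m≤m+n v (2 * B)) (≤-reflexive v+2B≡3+j)
  impossible : v ≤ 1 ⊎ v ≡ 2 + j ⊎ 5 + j ≤ v → B ≤ β ⊎ 2 + j ≤ B → ⊥
  impossible _ (inj₂ 2+j≤B) = 1+n≰n (begin
    4 + j       ≤⟨ +-mono-≤ (≤-trans (s≤s (s≤s z≤n)) 2+j≤B) (≤-trans 2+j≤B (m≤m+n B 0)) ⟩
    2 * B       ≤⟨ 2B≤3+j ⟩
    3 + j       ∎)
    where open ≤-Reasoning
  impossible cv (inj₁ B≤β) = middle cv
    where
    2B≤1+j : 2 * B ≤ 1 + j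
    2B≤1+j = ≤-trans (*-monoʳ-≤ 2 B≤β)
                     (subst (λ b → 2 * b ≤ 1 + j) (sym β≡) (2*[n/2∸2]≤n∸4 (5 + j)))
    2≤v : 2 ≤ v
    2≤v = +-cancelʳ-≤ (2 * B) 2 v (≤-trans (+-monoʳ-≤ 2 2B≤1+j) (≤-reflexive (sym v+2B≡3+j)))
    middle : v ≤ 1 ⊎ v ≡ 2 + j ⊎ 5 + j ≤ v → ⊥
    middle (inj₁ v≤1)          = 1+n≰n (≤-trans 2≤v v≤1)
    middle (inj₂ (inj₁ refl))  =
      2*n≢1 B (+-cancelˡ-≡ (2 + j) (2 * B) 1 (trans v+2B≡3+j (+-comm 1 (2 + j))))
    middle (inj₂ (inj₂ 5+j≤v)) = 1+n≰n (≤-trans (n≤1+n (4 + j)) (≤-trans 5+j≤v v≤3+j))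

lemma3p1 : (m α β : ℕ) → 9 ≤ m → Universal m (oneTwo α β) →
           ((α' β' : ℕ) → α ≤ α' → β ≤ β' → Universal m (oneTwo α' β'))
           × ((β' : ℕ) → β' ≤ β → Universal m (oneTwo (α + 2 * β') (β ∸ β')))
           × (((m ∸ 2 * β) ∸ 4) ⊔ 1 ≤ α)
           × (β ≡ (m / 2) ∸ 2 → 2 ≤ α)
lemma3p1 m α β 9≤m U with m≤n⇒∃[o]m+o≡n 9≤m
... | o , refl =
  (λ α′ β′ α≤α′ β≤β′ → Universal-oneTwo-mono α≤α′ β≤β′ U) ,
  (λ β′ β′≤β → Universal-oneTwo-halve β′≤β U) ,
  Universal-oneTwo-lower-bound (5 + o) α β U ,
  Universal-oneTwo-threshold (4 + o) α β U
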